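{- Fix $n$, an $n$-node input graph $G$ on identifiers $[n]$ with maximum degree at most $\Delta$, and the simulation $\mathrm{SIM}$ of an LCA algorithm $A$ with probe complexity $t(\cdot)$ and seed length $s(\cdot)$ on $G\cup H$ as described in the context, with $N=|V(G\cup H)|$ and $k=1+(\Delta+1)\,t(N)$. Let $\mathcal{F}$ be a family of $k$-wise independent permutations of $[N]$. Then for every $q\in V(G)$ and every $r\in\{0,1\}^{s(N)}$, $$\Pr_{\pi\in\mathcal{F}\text{ uniformly}}\big(\mathrm{SIM}(G,r,\pi,q)=0\big)\le \frac{kn}{N-k}.$$
   Context: Setup: $H$ is a fixed graph of maximum degree at most $\Delta$ on vertex set $[N]\setminus[n]$, known in advance; $G\cup H$ is the disjoint union, on vertex set $[N]$. For a permutation $\pi$ of $[N]$, the relabelled graph gives each node $v$ the identifier $\pi(v)$. On query $q\in V(G)$ with seed $r$, the simulation runs $A$ with seed $r$ on the relabelled $G\cup H$ on query $\pi(q)$, maintaining a set $Q$ of discovered nodes, initially $Q=\{q\}$. Whenever $A$ probes an identifier $w$, let $u=\pi^{ -1}(w)$: if $u\in Q$ (local probe) or $u\in V(H)$, the neighbours of $u$ (obtained from the oracle of $G$ or from the known graph $H$) are added to $Q$ and their relabelled identifiers are returned to $A$; if $u\notin Q$ and $u\in V(G)$, the simulation fails and stops. $\mathrm{SIM}(G,r,\pi,q)\in\{0,1\}$ is the indicator that the simulation on query $q$ with seed $r$ and permutation $\pi$ does not fail. A multiset $\mathcal{F}$ of permutations of $[N]$ is $k$-wise independent if for every $k$-tuple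 of distinct $x_1,\dots,x_k\in[N]$, the tuple $(f(x_1),\dots,f(x_k))$ for uniformly random $f\in\mathcal{F}$ is uniformly distributed over $k$-tuples of distinct elements of $[N]$. -}

module Defs where

open import Data.Nat using (ℕ; zero; suc; _+_; _*_; _≤_)
open import Data.Bool using (Bool; true; false)
open import Data.Fin using (Fin; _↑ˡ_; _↑ʳ_; splitAt)
open import Data.Fin.Properties using (_≟_)
open import Data.Fin.Permutation using (Permutation′; _⟨$⟩ʳ_; _⟨$⟩ˡ_)
open import Data.List using (List; []; _∷_; _++_; length; filter)
import Data.List as L
open import Data.List.Membership.Propositional using (_∈_; _∉_)
open import Data.List.Relation.Unary.Unique.Propositional renaming (Unique to UniqueL)
open import Data.Vec using (Vec)
import Data.Vec as V
open import Data.Vec.Properties using (≡-dec)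
open import Data.Vec.Relation.Unary.Unique.Propositional using (Unique)
open import Data.Maybe using (Maybe; just; nothing)
open import Data.Product using (_×_; _,_)
open import Data.Sum using (inj₁; inj₂)
open import Relation.Nullary using (yes; no; ¬_)
open import Relation.Binary.PropositionalEquality using (_≡_)
open import Data.List.Relation.Unary.Any using (any?)

record Graph (V : ℕ) : Set where
  field
    adj       : Fin V → List (Fin V)
    symmetric : ∀ u v → v ∈ adj u → u ∈ adj v
    loopless  : ∀ u → u ∉ adj u
    noRepeat  : ∀ u → UniqueL (adj u)
open Graph public

MaxDegree≤ : ∀ {V} → ℕ → Graph V → Set
MaxDegree≤ Δ G = ∀ u → length (adj G u) ≤ Δ

-- Disjoint union G ∪ H on Fin (n + m): G on the first n identifiers
-- ([n]), H on the remaining m identifiers ([N] \ [n]).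
unionAdj : ∀ {n m} → Graph n → Graph m → Fin (n + m) → List (Fin (n + m))
unionAdj {n} {m} G H v with splitAt n v
... | inj₁ i = L.map (_↑ˡ m) (adj G i)
... | inj₂ j = L.map (n ↑ʳ_) (adj H j)

inH : ∀ n {m} → Fin (n + m) → Bool
inH n u with splitAt n u
... | inj₁ _ = false
... | inj₂ _ = true

-- On a graph with N nodes (identifiers Fin N), with a
-- seed of length s N and a query identifier, the algorithm adaptively
-- chooses its next probe from the history of previous probes and the
-- answers (neighbour-identifier lists), or halts (nothing).
-- Probe complexity t: it is run for at most t N probes.

History : ℕ → Set
History N = List (Fin N × List (Fin N))

record LCA (t s : ℕ → ℕ) : Set where
  field
    next : (N : ℕ) → Vec Bool (s N) → Fin N → History N → Maybe (Fin N)
open LCA public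

-- The simulation SIM(G, r, π, q): true = does not fail.

module _ {t s : ℕ → ℕ} (A : LCA t s) {n m : ℕ} (G : Graph n) (H : Graph m)
         (r : Vec Bool (s (n + m))) (π : Permutation′ (n + m)) where

  private
    N = n + m

  -- may u be probed? (u ∈ Q, a local probe, or u ∈ V(H))
  allowed : Fin N → List (Fin N) → Bool
  allowed u Q with any? (_≟_ u) Q
  ... | yes _ = true
  ... | no  _ = inH n u

  simLoop : ℕ → Fin N → List (Fin N) → History N → Bool
  simLoop zero       _  _ _ = true
  simLoop (suc fuel) πq Q h with next A N r πq h
  ... | nothing = true
  ... | just w with allowed (π ⟨$⟩ˡ w) Q
  ...   | false = false
  ...   | true  = simLoop fuel πq (unionAdj G H (π ⟨$⟩ˡ w) ++ Q)
                    ((w , L.map (π ⟨$⟩ʳ_) (unionAdj G H (π ⟨$⟩ˡ w))) ∷ h)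

SIM : ∀ {t s} (A : LCA t s) {n m} (G : Graph n) (H : Graph m) →
      Vec Bool (s (n + m)) → Permutation′ (n + m) → Fin n → Bool
SIM {t} A {n} {m} G H r π q =
  simLoop A G H r π (t (n + m)) (π ⟨$⟩ʳ (q ↑ˡ m)) ((q ↑ˡ m) ∷ []) []

applyVec : ∀ {N k} → Permutation′ N → Vec (Fin N) k → Vec (Fin N) k
applyVec f xs = V.map (f ⟨$⟩ʳ_) xs

countMaps : ∀ {N k} → List (Permutation′ N) → Vec (Fin N) k → Vec (Fin N) k → ℕ
countMaps F xs ys = length (filter (λ f → ≡-dec _≟_ (applyVec f xs) ys) F)

-- k-wise independence: for distinct x₁..x_k, the tuple (f x₁,…,f x_k)
-- (f uniform from F) is uniform over tuples of k distinct elements,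
-- i.e. every such target tuple is hit by equally many f in F.
KWiseIndependent : ∀ {N} → ℕ → List (Permutation′ N) → Set
KWiseIndependent {N} k F =
  ∀ (xs ys ys′ : Vec (Fin N) k) → Unique xs → Unique ys → Unique ys′ →
  countMaps F xs ys ≡ countMaps F xs ys′

failCount : ∀ {t s} (A : LCA t s) {n m} (G : Graph n) (H : Graph m) →
            Vec Bool (s (n + m)) → List (Permutation′ (n + m)) → Fin n → ℕ
failCount A G H r F q =
  length (filter (λ π → Data.Bool._≟_ (SIM A G H r π q) false) F)
  where import Data.Bool

module Submission where

-- Reveal π lazily: a state of the simulation is accompanied by a
-- partial assignment xs ↦ ys (the nodes whose identifiers are known so
-- far) and we count the members of F realising it. By k-wise independence
-- (propagated down from size k), every assignment of size j < k that is
-- extended by one fresh pair loses a factor N − j ≥ N − k of realisers.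
-- When A probes a new identifier, its preimage is a uniformly random
-- unassigned node, so it lies in G (the only way to fail) with
-- probability ≤ n / (N − k); a probe of a known identifier, or one landing
-- in H, just reveals ≤ Δ neighbours, which are assigned one at a time.
-- Each of the t(N) steps thus costs ≤ n / (N − k) and assigns ≤ Δ + 1
-- nodes, which keeps the assignment below size k. Probabilities appear
-- as counts over F, with denominators multiplied out.

open import Defs
open import Data.Nat using (ℕ; zero; suc; _+_; _*_; _∸_; _≤_; _<_; z≤n; s≤s)
open import Data.Nat.Properties
  using ( +-*-semiring; +-identityʳ; +-suc; +-comm; +-assoc; *-comm; *-assoc; *-identityˡ; *-identityʳ
        ; *-zeroʳ; *-distribʳ-+; +-mono-≤; *-mono-≤; *-monoˡ-≤; +-monoˡ-≤; +-monoʳ-≤; ∸-monoʳ-≤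
        ; ≤-refl; ≤-reflexive; ≤-trans; <-trans; <-≤-trans; <⇒≤; n≤1+n; m≤m+n; m≤n+m; m<m+n
        ; m+n∸m≡n; m+[n∸m]≡n; m<n⇒0<n∸m; <-irrefl; module ≤-Reasoning)
open import Data.Bool using (Bool; true; false; if_then_else_)
import Data.Bool as Bool
open import Data.Fin using (Fin; zero; suc; _↑ˡ_; _↑ʳ_; splitAt)
open import Data.Fin.Properties using (_≟_)
import Data.Fin.Properties as Fin
open import Data.Fin.Permutation using (Permutation′; _⟨$⟩ʳ_; _⟨$⟩ˡ_; inverseˡ; inverseʳ)
open import Data.List using (List; []; _∷_; length; filter; _++_; lookup)
import Data.List as List
import Data.List.Properties as List
open import Data.List.Membership.Propositional using (_∈_)
open import Data.List.Membership.Propositional.Properties using (∈-++⁺ˡ; ∈-++⁺ʳ; ∈-++⁻)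
import Data.List.Relation.Unary.All as ListAll
open import Data.List.Relation.Unary.Any using (here; there; any?)
open import Data.Vec using (Vec; []; _∷_)
open import Data.Vec.Properties using (≡-dec; ∷-injectiveˡ; ∷-injectiveʳ)
open import Data.Vec.Relation.Unary.Unique.Propositional using (Unique; []; _∷_)
open import Data.Vec.Relation.Unary.All using (All; []; _∷_)
open import Data.Vec.Relation.Unary.Any as VecAny using (here; there)
open import Data.Vec.Membership.Propositional using () renaming (_∈_ to _∈ᵥ_)
open import Data.Maybe using (just; nothing)
open import Data.Product using (∃; _×_; _,_)
open import Data.Sum using (_⊎_; inj₁; inj₂)
import Data.Sum as Sum
open import Data.Empty using (⊥-elim)
open import Function using (_∘_; _⇔_; mk⇔; Equivalence; Injection)
open import Function.Properties.Inverse using (↔⇒↣)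
open import Relation.Nullary using (Dec; yes; no; ¬_; does; ¬?)
open import Relation.Unary using (Decidable)
open import Relation.Binary.PropositionalEquality
open import Algebra.Properties.Semiring.Sum +-*-semiring
  using (sum; sum-syntax; sum-cong-≗; ∑-distrib-+; ∑-comm; *-distribˡ-sum; *-distribʳ-sum
        ; sum-replicate-zero)

𝟙 : ∀ {p} {P : Set p} → Dec P → ℕ
𝟙 d = if does d then 1 else 0

𝟙-yes : ∀ {p} {P : Set p} (d : Dec P) → P → 𝟙 d ≡ 1
𝟙-yes (yes _) _ = refl
𝟙-yes (no ¬p) p = ⊥-elim (¬p p)

𝟙-no : ∀ {p} {P : Set p} (d : Dec P) → ¬ P → 𝟙 d ≡ 0
𝟙-no (yes p) ¬p = ⊥-elim (¬p p)
𝟙-no (no _) _ = refl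

𝟙≤1 : ∀ {p} {P : Set p} (d : Dec P) → 𝟙 d ≤ 1
𝟙≤1 (yes _) = s≤s z≤n
𝟙≤1 (no _) = z≤n

𝟙-cong : ∀ {p q} {P : Set p} {Q : Set q} (d : Dec P) (e : Dec Q) → P ⇔ Q → 𝟙 d ≡ 𝟙 e
𝟙-cong d (yes q) P⇔Q = 𝟙-yes d (Equivalence.from P⇔Q q)
𝟙-cong d (no ¬q) P⇔Q = 𝟙-no d (¬q ∘ Equivalence.to P⇔Q)

𝟙-complement : ∀ {p} {P : Set p} (d : Dec P) → 𝟙 d + 𝟙 (¬? d) ≡ 1
𝟙-complement (yes _) = refl
𝟙-complement (no _) = refl

sum-mono-≤ : ∀ {N} {f g : Fin N → ℕ} → (∀ i → f i ≤ g i) → sum f ≤ sum g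
sum-mono-≤ {zero} f≤g = z≤n
sum-mono-≤ {suc N} f≤g = +-mono-≤ (f≤g zero) (sum-mono-≤ (f≤g ∘ suc))

sum-zero : ∀ {N} {f : Fin N → ℕ} → (∀ i → f i ≡ 0) → sum f ≡ 0
sum-zero {N} f≡0 = trans (sum-cong-≗ f≡0) (sum-replicate-zero N)

sum-𝟙-singleton : ∀ {N} (a : Fin N) → ∑[ y < N ] 𝟙 (y ≟ a) ≡ 1
sum-𝟙-singleton {suc N} zero = cong suc (sum-replicate-zero N)
sum-𝟙-singleton {suc N} (suc a) = sum-𝟙-singleton a

sum-const-1 : ∀ N → ∑[ y < N ] 1 ≡ N
sum-const-1 zero = refl
sum-const-1 (suc N) = cong suc (sum-const-1 N)

_∈ᵥ?_ : ∀ {N j} (x : Fin N) (xs : Vec (Fin N) j) → Dec (x ∈ᵥ xs)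
x ∈ᵥ? xs = VecAny.any? (x ≟_) xs

∉⇒All≢ : ∀ {N j} {x : Fin N} (xs : Vec (Fin N) j) → ¬ x ∈ᵥ xs → All (x ≢_) xs
∉⇒All≢ [] _ = []
∉⇒All≢ (z ∷ xs) x∉ = (x∉ ∘ here) ∷ ∉⇒All≢ xs (x∉ ∘ there)

All≢⇒∉ : ∀ {N j} {x : Fin N} {xs : Vec (Fin N) j} → All (x ≢_) xs → ¬ x ∈ᵥ xs
All≢⇒∉ (x≢z ∷ _) (here x≡z) = x≢z x≡z
All≢⇒∉ (_ ∷ x≢xs) (there x∈xs) = All≢⇒∉ x≢xs x∈xs

unique-∷ : ∀ {N j} {x : Fin N} {xs : Vec (Fin N) j} → ¬ x ∈ᵥ xs → Unique xs → Unique (x ∷ xs)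
unique-∷ {xs = xs} x∉ u = ∉⇒All≢ xs x∉ ∷ u

sum-𝟙-∈ : ∀ {N j} (ys : Vec (Fin N) j) → Unique ys → ∑[ y < N ] 𝟙 (y ∈ᵥ? ys) ≡ j
sum-𝟙-∈ {N} [] [] = sum-zero {N} (λ _ → refl)
sum-𝟙-∈ {N} {suc j} (a ∷ ys) (a∉ys ∷ u) = begin
  ∑[ y < N ] 𝟙 (y ∈ᵥ? (a ∷ ys))             ≡⟨ sum-cong-≗ (λ y → split (y ≟ a) (y ∈ᵥ? ys)) ⟩
  ∑[ y < N ] (𝟙 (y ≟ a) + 𝟙 (y ∈ᵥ? ys))      ≡⟨ ∑-distrib-+ (λ y → 𝟙 (y ≟ a)) (λ y → 𝟙 (y ∈ᵥ? ys)) ⟩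
  ∑[ y < N ] 𝟙 (y ≟ a) + ∑[ y < N ] 𝟙 (y ∈ᵥ? ys) ≡⟨ cong₂ _+_ (sum-𝟙-singleton a) (sum-𝟙-∈ ys u) ⟩
  suc j ∎
  where
  open ≡-Reasoning
  split : ∀ {y} (y≟a : Dec (y ≡ a)) (y∈?ys : Dec (y ∈ᵥ ys)) → 𝟙 (y ∈ᵥ? (a ∷ ys)) ≡ 𝟙 y≟a + 𝟙 y∈?ys
  split (yes refl) (yes y∈ys) = ⊥-elim (All≢⇒∉ a∉ys y∈ys)
  split (yes refl) (no _) = 𝟙-yes (_ ∈ᵥ? (a ∷ ys)) (here refl)
  split (no _) (yes y∈ys) = 𝟙-yes (_ ∈ᵥ? (a ∷ ys)) (there y∈ys)
  split (no y≢a) (no y∉ys) = 𝟙-no (_ ∈ᵥ? (a ∷ ys)) λ { (here y≡a) → y≢a y≡a ; (there y∈ys) → y∉ys y∈ys }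

sum-𝟙-∉ : ∀ {N j} (ys : Vec (Fin N) j) → Unique ys → ∑[ y < N ] 𝟙 (¬? (y ∈ᵥ? ys)) ≡ N ∸ j
sum-𝟙-∉ {N} {j} ys u = begin
  outside                ≡⟨ m+n∸m≡n j outside ⟨
  j + outside ∸ j        ≡⟨ cong (λ k → k + outside ∸ j) (sum-𝟙-∈ ys u) ⟨
  inside + outside ∸ j   ≡⟨ cong (_∸ j) (∑-distrib-+ (λ y → 𝟙 (y ∈ᵥ? ys)) (λ y → 𝟙 (¬? (y ∈ᵥ? ys)))) ⟨
  ∑[ y < N ] (𝟙 (y ∈ᵥ? ys) + 𝟙 (¬? (y ∈ᵥ? ys))) ∸ j ≡⟨ cong (_∸ j) (sum-cong-≗ (λ y → 𝟙-complement (y ∈ᵥ? ys))) ⟩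
  ∑[ y < N ] 1 ∸ j        ≡⟨ cong (_∸ j) (sum-const-1 N) ⟩
  N ∸ j ∎
  where
  open ≡-Reasoning
  inside outside : ℕ
  inside = ∑[ y < N ] 𝟙 (y ∈ᵥ? ys)
  outside = ∑[ y < N ] 𝟙 (¬? (y ∈ᵥ? ys))

fresh : ∀ {N j} (xs : Vec (Fin N) j) → Unique xs → j < N → ∃ λ x → ¬ x ∈ᵥ xs
fresh {N} {j} xs u j<N with Fin.any? (λ x → ¬? (x ∈ᵥ? xs))
... | yes found = found
... | no none = ⊥-elim (<-irrefl refl (subst (0 <_) no-point-outside (m<n⇒0<n∸m j<N)))
  where
  no-point-outside : N ∸ j ≡ 0
  no-point-outside = trans (sym (sum-𝟙-∉ xs u))
    (sum-zero (λ y → 𝟙-no (¬? (y ∈ᵥ? xs)) (λ y∉xs → none (y , y∉xs))))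

length-filter-sum : ∀ {a p} {A : Set a} {P : A → Set p} (P? : Decidable P) (xs : List A) →
  length (filter P? xs) ≡ ∑[ i < length xs ] 𝟙 (P? (lookup xs i))
length-filter-sum P? [] = refl
length-filter-sum P? (x ∷ xs) with does (P? x)
... | true = cong suc (length-filter-sum P? xs)
... | false = length-filter-sum P? xs

sum-𝟙-unique : ∀ {N p} {P : Fin N → Set p} (P? : Decidable P) (a : Fin N) →
  P a → (∀ y → P y → y ≡ a) → ∑[ y < N ] 𝟙 (P? y) ≡ 1
sum-𝟙-unique P? a Pa only-a =
  trans (sum-cong-≗ (λ y → 𝟙-cong (P? y) (y ≟ a) (mk⇔ (only-a y) (λ { refl → Pa }))))
        (sum-𝟙-singleton a)

-- A pair of duplicate-free vectors (xs , ys) of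
-- equal length j stands for the partial map xs ↦ ys; a permutation
-- realises it if it maps each entry of xs to the matching entry of ys.

module Assignments {N : ℕ} (F : List (Permutation′ N)) where

  _⊨_↦_ : ∀ {j} → Permutation′ N → Vec (Fin N) j → Vec (Fin N) j → Set
  f ⊨ xs ↦ ys = applyVec f xs ≡ ys

  realises? : ∀ {j} (f : Permutation′ N) (xs ys : Vec (Fin N) j) → Dec (f ⊨ xs ↦ ys)
  realises? f xs ys = ≡-dec _≟_ (applyVec f xs) ys

  image∈ : ∀ {j} {f : Permutation′ N} {xs ys : Vec (Fin N) j} {u : Fin N} →
    f ⊨ xs ↦ ys → u ∈ᵥ xs → f ⟨$⟩ʳ u ∈ᵥ ys
  image∈ {xs = _ ∷ _} {_ ∷ _} f⊨ (here refl) = here (∷-injectiveˡ f⊨)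
  image∈ {f = f} {_ ∷ _} {_ ∷ _} f⊨ (there u∈) = there (image∈ {f = f} (∷-injectiveʳ f⊨) u∈)

  preimage∈ : ∀ {j} {f : Permutation′ N} {xs ys : Vec (Fin N) j} {u : Fin N} →
    f ⊨ xs ↦ ys → f ⟨$⟩ʳ u ∈ᵥ ys → u ∈ᵥ xs
  preimage∈ {f = f} {_ ∷ _} {_ ∷ _} f⊨ (here fu≡y) =
    here (Injection.injective (↔⇒↣ f) (trans fu≡y (sym (∷-injectiveˡ f⊨))))
  preimage∈ {f = f} {_ ∷ _} {_ ∷ _} f⊨ (there fu∈) = there (preimage∈ {f = f} (∷-injectiveʳ f⊨) fu∈)

  new↦used : ∀ {j} {f : Permutation′ N} {xs ys : Vec (Fin N) j} {x y : Fin N} →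
    ¬ x ∈ᵥ xs → y ∈ᵥ ys → ¬ f ⊨ (x ∷ xs) ↦ (y ∷ ys)
  new↦used {f = f} {ys = ys} x∉ y∈ f⊨ =
    x∉ (preimage∈ {f = f} (∷-injectiveʳ f⊨) (subst (_∈ᵥ ys) (sym (∷-injectiveˡ f⊨)) y∈))

  used↦new : ∀ {j} {f : Permutation′ N} {xs ys : Vec (Fin N) j} {x y : Fin N} →
    x ∈ᵥ xs → ¬ y ∈ᵥ ys → ¬ f ⊨ (x ∷ xs) ↦ (y ∷ ys)
  used↦new {f = f} {ys = ys} x∈ y∉ f⊨ =
    y∉ (subst (_∈ᵥ ys) (∷-injectiveˡ f⊨) (image∈ {f = f} (∷-injectiveʳ f⊨) x∈))

  preimage : ∀ {j} (xs ys : Vec (Fin N) j) {w : Fin N} → w ∈ᵥ ys →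
    ∃ λ u → u ∈ᵥ xs × (∀ f → f ⊨ xs ↦ ys → f ⟨$⟩ʳ u ≡ w)
  preimage (x ∷ xs) (y ∷ ys) (here refl) = x , here refl , λ f f⊨ → ∷-injectiveˡ f⊨
  preimage (x ∷ xs) (y ∷ ys) (there w∈) with preimage xs ys w∈
  ... | u , u∈ , fu≡w = u , there u∈ , λ f f⊨ → fu≡w f (∷-injectiveʳ f⊨)

  assigned : ∀ {j} → Vec (Fin N) j → Vec (Fin N) j → Fin N → Fin N
  assigned [] [] v = v
  assigned (x ∷ xs) (y ∷ ys) v with v ≟ x
  ... | yes _ = y
  ... | no _ = assigned xs ys v

  assigned-correct : ∀ {j} {f : Permutation′ N} (xs ys : Vec (Fin N) j) {v : Fin N} →
    f ⊨ xs ↦ ys → v ∈ᵥ xs → f ⟨$⟩ʳ v ≡ assigned xs ys v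
  assigned-correct {f = f} (x ∷ xs) (y ∷ ys) {v} f⊨ v∈ with v ≟ x | v∈
  ... | yes refl | _ = ∷-injectiveˡ f⊨
  ... | no v≢x | here v≡x = ⊥-elim (v≢x v≡x)
  ... | no _ | there v∈xs = assigned-correct {f = f} xs ys (∷-injectiveʳ f⊨) v∈xs

  weight : ∀ {j} → Vec (Fin N) j → Vec (Fin N) j → (Permutation′ N → ℕ) → ℕ
  weight xs ys g = ∑[ i < length F ] (𝟙 (realises? (lookup F i) xs ys) * g (lookup F i))

  count : ∀ {j} → Vec (Fin N) j → Vec (Fin N) j → ℕ
  count xs ys = weight xs ys (λ _ → 1)

  countMaps≡count : ∀ {j} (xs ys : Vec (Fin N) j) → countMaps F xs ys ≡ count xs ys
  countMaps≡count xs ys = trans (length-filter-sum (λ f → realises? f xs ys) F)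
    (sum-cong-≗ {length F} (λ i → sym (*-identityʳ _)))

  weight-empty : ∀ g → weight [] [] g ≡ ∑[ i < length F ] g (lookup F i)
  weight-empty g = sum-cong-≗ {length F} (λ i → +-identityʳ (g (lookup F i)))

  count-empty : count [] [] ≡ length F
  count-empty = trans (weight-empty (λ _ → 1)) (sum-const-1 (length F))

  weight-cong : ∀ {j} (xs ys : Vec (Fin N) j) {g g′ : Permutation′ N → ℕ} →
    (∀ f → f ⊨ xs ↦ ys → g f ≡ g′ f) → weight xs ys g ≡ weight xs ys g′
  weight-cong xs ys {g} {g′} g≡g′ = sum-cong-≗ λ i → on (lookup F i)
    where
    on : ∀ f → 𝟙 (realises? f xs ys) * g f ≡ 𝟙 (realises? f xs ys) * g′ f
    on f with realises? f xs ys
    ... | yes f⊨ = cong (1 *_) (g≡g′ f f⊨)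
    ... | no _ = refl

  weight-zero : ∀ {j} (xs ys : Vec (Fin N) j) {g : Permutation′ N → ℕ} →
    (∀ f → f ⊨ xs ↦ ys → g f ≡ 0) → weight xs ys g ≡ 0
  weight-zero xs ys g≡0 =
    trans (weight-cong xs ys g≡0) (sum-zero {length F} (λ i → *-zeroʳ (𝟙 (realises? (lookup F i) xs ys))))

  weight-≤-count : ∀ {j} (xs ys : Vec (Fin N) j) {g : Permutation′ N → ℕ} →
    (∀ f → g f ≤ 1) → weight xs ys g ≤ count xs ys
  weight-≤-count xs ys g≤1 =
    sum-mono-≤ (λ i → *-mono-≤ (≤-refl {𝟙 (realises? (lookup F i) xs ys)}) (g≤1 (lookup F i)))

  weight-vanishing-bound : ∀ {j} (xs ys : Vec (Fin N) j) {g : Permutation′ N → ℕ} {c b : ℕ} →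
    (∀ f → f ⊨ xs ↦ ys → g f ≡ 0) → weight xs ys g * c ≤ b
  weight-vanishing-bound xs ys {c = c} {b} g≡0 =
    subst (λ w → w * c ≤ b) (sym (weight-zero xs ys g≡0)) z≤n

  𝟙-realises-∷ : ∀ {j} f x y (xs ys : Vec (Fin N) j) →
    𝟙 (realises? f (x ∷ xs) (y ∷ ys)) ≡ 𝟙 (f ⟨$⟩ʳ x ≟ y) * 𝟙 (realises? f xs ys)
  𝟙-realises-∷ f x y xs ys = factor (f ⟨$⟩ʳ x ≟ y) (realises? f xs ys)
    where
    factor : (d₁ : Dec (f ⟨$⟩ʳ x ≡ y)) (d₂ : Dec (f ⊨ xs ↦ ys)) →
      𝟙 (realises? f (x ∷ xs) (y ∷ ys)) ≡ 𝟙 d₁ * 𝟙 d₂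
    factor (yes fx≡y) (yes f⊨) = 𝟙-yes (realises? f (x ∷ xs) (y ∷ ys)) (cong₂ _∷_ fx≡y f⊨)
    factor (yes _) (no f⊭) = 𝟙-no (realises? f (x ∷ xs) (y ∷ ys)) (f⊭ ∘ ∷-injectiveʳ)
    factor (no fx≢y) _ = 𝟙-no (realises? f (x ∷ xs) (y ∷ ys)) (fx≢y ∘ ∷-injectiveˡ)

  ExactlyOneMatch : (Fin N → Fin N) → (Fin N → Fin N) → Set
  ExactlyOneMatch x y = ∀ f → ∃ λ a → f ⟨$⟩ʳ x a ≡ y a × (∀ k → f ⟨$⟩ʳ x k ≡ y k → k ≡ a)

  image-match : ∀ x → ExactlyOneMatch (λ _ → x) (λ y → y)
  image-match x f = f ⟨$⟩ʳ x , refl , λ y fx≡y → sym fx≡y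

  preimage-match : ∀ w → ExactlyOneMatch (λ u → u) (λ _ → w)
  preimage-match w f = f ⟨$⟩ˡ w , inverseʳ f , λ u fu≡w → trans (sym (inverseˡ f)) (cong (f ⟨$⟩ˡ_) fu≡w)

  -- Law of total probability: under an exact match, the extensions
  -- (x k ∷ xs) ↦ (y k ∷ ys) partition the realisers of xs ↦ ys.
  weight-split : ∀ {j} {x y : Fin N → Fin N} → ExactlyOneMatch x y →
    (xs ys : Vec (Fin N) j) (g : Permutation′ N → ℕ) →
    ∑[ k < N ] weight (x k ∷ xs) (y k ∷ ys) g ≡ weight xs ys g
  weight-split {x = x} {y} exactly-one xs ys g =
    trans (∑-comm (λ k i → 𝟙 (realises? (lookup F i) (x k ∷ xs) (y k ∷ ys)) * g (lookup F i)))
          (sum-cong-≗ {length F} (λ i → collapse (lookup F i)))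
    where
    open ≡-Reasoning
    collapse : ∀ f → ∑[ k < N ] (𝟙 (realises? f (x k ∷ xs) (y k ∷ ys)) * g f) ≡ 𝟙 (realises? f xs ys) * g f
    collapse f with exactly-one f
    ... | a , hit , only-a = begin
      ∑[ k < N ] (𝟙 (realises? f (x k ∷ xs) (y k ∷ ys)) * g f)
        ≡⟨ sum-cong-≗ (λ k → trans (cong (_* g f) (𝟙-realises-∷ f (x k) (y k) xs ys))
                                  (*-assoc (𝟙 (f ⟨$⟩ʳ x k ≟ y k)) (𝟙 (realises? f xs ys)) (g f))) ⟩
      ∑[ k < N ] (𝟙 (f ⟨$⟩ʳ x k ≟ y k) * c)
        ≡⟨ *-distribʳ-sum c (λ k → 𝟙 (f ⟨$⟩ʳ x k ≟ y k)) ⟨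
      ∑[ k < N ] 𝟙 (f ⟨$⟩ʳ x k ≟ y k) * c
        ≡⟨ cong (_* c) (sum-𝟙-unique (λ k → f ⟨$⟩ʳ x k ≟ y k) a hit only-a) ⟩
      1 * c
        ≡⟨ *-identityˡ c ⟩
      c ∎
      where
      c : ℕ
      c = 𝟙 (realises? f xs ys) * g f

  weight-split-bound : ∀ {j} {x y : Fin N → Fin N} → ExactlyOneMatch x y →
    (xs ys : Vec (Fin N) j) (g : Permutation′ N → ℕ) (c B : ℕ) (a : Fin N → ℕ) →
    (∀ k → weight (x k ∷ xs) (y k ∷ ys) g * c ≤ a k + B * count (x k ∷ xs) (y k ∷ ys)) →
    weight xs ys g * c ≤ sum a + B * count xs ys
  weight-split-bound {x = x} {y} match xs ys g c B a piece = begin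
    weight xs ys g * c                              ≡⟨ cong (_* c) (weight-split match xs ys g) ⟨
    (∑[ k < N ] weight (x k ∷ xs) (y k ∷ ys) g) * c  ≡⟨ *-distribʳ-sum c (λ k → weight (x k ∷ xs) (y k ∷ ys) g) ⟩
    ∑[ k < N ] (weight (x k ∷ xs) (y k ∷ ys) g * c)  ≤⟨ sum-mono-≤ piece ⟩
    ∑[ k < N ] (a k + B * count (x k ∷ xs) (y k ∷ ys))
      ≡⟨ ∑-distrib-+ a (λ k → B * count (x k ∷ xs) (y k ∷ ys)) ⟩
    sum a + ∑[ k < N ] (B * count (x k ∷ xs) (y k ∷ ys))
      ≡⟨ cong (sum a +_) (*-distribˡ-sum B (λ k → count (x k ∷ xs) (y k ∷ ys))) ⟨
    sum a + B * ∑[ k < N ] count (x k ∷ xs) (y k ∷ ys) ≡⟨ cong (λ z → sum a + B * z) (weight-split match xs ys (λ _ → 1)) ⟩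
    sum a + B * count xs ys ∎
    where open ≤-Reasoning

  image-split-bound : ∀ {j} x (xs ys : Vec (Fin N) j) (g : Permutation′ N → ℕ) (c B : ℕ) →
    (∀ y → weight (x ∷ xs) (y ∷ ys) g * c ≤ B * count (x ∷ xs) (y ∷ ys)) →
    weight xs ys g * c ≤ B * count xs ys
  image-split-bound x xs ys g c B piece =
    subst (weight xs ys g * c ≤_) (cong (_+ B * count xs ys) (sum-replicate-zero N))
      (weight-split-bound (image-match x) xs ys g c B (λ _ → 0) piece)

  ValueIndependent : ℕ → Set
  ValueIndependent j = ∀ (xs ys ys′ : Vec (Fin N) j) →
    Unique xs → Unique ys → Unique ys′ → count xs ys ≡ count xs ys′

  count-extension : ∀ {j} → ValueIndependent (suc j) → (xs ys : Vec (Fin N) j) (x y₀ : Fin N) →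
    ¬ x ∈ᵥ xs → ¬ y₀ ∈ᵥ ys → Unique xs → Unique ys →
    count xs ys ≡ (N ∸ j) * count (x ∷ xs) (y₀ ∷ ys)
  count-extension {j} independent xs ys x y₀ x∉ y₀∉ uxs uys = begin
    count xs ys                                  ≡⟨ weight-split (image-match x) xs ys (λ _ → 1) ⟨
    ∑[ y < N ] count (x ∷ xs) (y ∷ ys)           ≡⟨ sum-cong-≗ extension ⟩
    ∑[ y < N ] (𝟙 (¬? (y ∈ᵥ? ys)) * c)           ≡⟨ *-distribʳ-sum c (λ y → 𝟙 (¬? (y ∈ᵥ? ys))) ⟨
    ∑[ y < N ] 𝟙 (¬? (y ∈ᵥ? ys)) * c             ≡⟨ cong (_* c) (sum-𝟙-∉ ys uys) ⟩
    (N ∸ j) * c ∎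
    where
    open ≡-Reasoning
    c : ℕ
    c = count (x ∷ xs) (y₀ ∷ ys)
    extension : ∀ y → count (x ∷ xs) (y ∷ ys) ≡ 𝟙 (¬? (y ∈ᵥ? ys)) * c
    extension y with y ∈ᵥ? ys
    ... | yes y∈ = weight-zero (x ∷ xs) (y ∷ ys) (λ f f⊨ → ⊥-elim (new↦used {f = f} x∉ y∈ f⊨))
    ... | no y∉ = trans
      (independent (x ∷ xs) (y ∷ ys) (y₀ ∷ ys) (unique-∷ x∉ uxs) (unique-∷ y∉ uys) (unique-∷ y₀∉ uys))
      (sym (+-identityʳ c))

  module Independence (K : ℕ) (K<N : K < N) (kwise : KWiseIndependent K F) where

    value-independent : ∀ d {j} → j + d ≡ K → ValueIndependent j
    value-independent zero {j} j+0≡K xs ys ys′ uxs uys uys′ rewrite +-identityʳ j | j+0≡K =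
      trans (sym (countMaps≡count xs ys)) (trans (kwise xs ys ys′ uxs uys uys′) (countMaps≡count xs ys′))
    value-independent (suc d) {j} j+1+d≡K xs ys ys′ uxs uys uys′
      with fresh xs uxs j<N | fresh ys uys j<N | fresh ys′ uys′ j<N
      where
      j<N : j < N
      j<N = <-trans (subst (j <_) j+1+d≡K (m<m+n j (s≤s z≤n))) K<N
    ... | x , x∉ | y₀ , y₀∉ | y₁ , y₁∉ = begin
      count xs ys                             ≡⟨ count-extension above xs ys x y₀ x∉ y₀∉ uxs uys ⟩
      (N ∸ j) * count (x ∷ xs) (y₀ ∷ ys)      ≡⟨ cong ((N ∸ j) *_) (above (x ∷ xs) (y₀ ∷ ys) (y₁ ∷ ys′)
                                                   (unique-∷ x∉ uxs) (unique-∷ y₀∉ uys) (unique-∷ y₁∉ uys′)) ⟩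
      (N ∸ j) * count (x ∷ xs) (y₁ ∷ ys′)     ≡⟨ count-extension above xs ys′ x y₁ x∉ y₁∉ uxs uys′ ⟨
      count xs ys′ ∎
      where
      open ≡-Reasoning
      above : ValueIndependent (suc j)
      above = value-independent d (trans (sym (+-suc j d)) j+1+d≡K)

    count-extend : ∀ {j} → j < K → (xs ys : Vec (Fin N) j) (x y : Fin N) →
      ¬ x ∈ᵥ xs → ¬ y ∈ᵥ ys → Unique xs → Unique ys →
      count xs ys ≡ (N ∸ j) * count (x ∷ xs) (y ∷ ys)
    count-extend {j} j<K = count-extension (value-independent (K ∸ suc j) (m+[n∸m]≡n j<K))

    fresh-pair-bound : ∀ {j} → j < K → (xs ys : Vec (Fin N) j) (x y : Fin N) →
      ¬ x ∈ᵥ xs → ¬ y ∈ᵥ ys → Unique xs → Unique ys → {g : Permutation′ N → ℕ} → (∀ f → g f ≤ 1) →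
      weight (x ∷ xs) (y ∷ ys) g * (N ∸ K) ≤ count xs ys
    fresh-pair-bound {j} j<K xs ys x y x∉ y∉ uxs uys {g} g≤1 = begin
      weight (x ∷ xs) (y ∷ ys) g * (N ∸ K)  ≤⟨ *-mono-≤ (weight-≤-count (x ∷ xs) (y ∷ ys) g≤1) (∸-monoʳ-≤ N (<⇒≤ j<K)) ⟩
      count (x ∷ xs) (y ∷ ys) * (N ∸ j)     ≡⟨ *-comm (count (x ∷ xs) (y ∷ ys)) (N ∸ j) ⟩
      (N ∸ j) * count (x ∷ xs) (y ∷ ys)     ≡⟨ count-extend j<K xs ys x y x∉ y∉ uxs uys ⟨
      count xs ys ∎
      where open ≤-Reasoning

unionAdj-degree : ∀ {Δ n m} {G : Graph n} {H : Graph m} → MaxDegree≤ Δ G → MaxDegree≤ Δ H →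
  ∀ u → length (unionAdj G H u) ≤ Δ
unionAdj-degree {Δ} {n} {m} {G} {H} degG degH u with splitAt n u
... | inj₁ i = subst (_≤ Δ) (sym (List.length-map (_↑ˡ m) (adj G i))) (degG i)
... | inj₂ i = subst (_≤ Δ) (sym (List.length-map (n ↑ʳ_) (adj H i))) (degH i)

isFalse : Bool → ℕ
isFalse b = 𝟙 (b Bool.≟ false)

inH-suc : ∀ n {m} (u : Fin (n + m)) → inH (suc n) (suc u) ≡ inH n u
inH-suc n u with splitAt n u
... | inj₁ _ = refl
... | inj₂ _ = refl

count-G-nodes : ∀ n {m} → ∑[ u < n + m ] isFalse (inH n u) ≡ n
count-G-nodes zero {m} = sum-replicate-zero m
count-G-nodes (suc n) = cong suc (trans (sum-cong-≗ (λ u → cong isFalse (inH-suc n u))) (count-G-nodes n))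

module Unfolding {t s : ℕ → ℕ} (A : LCA t s) {n m : ℕ} (G : Graph n) (H : Graph m)
                 (r : Vec Bool (s (n + m))) where

  Probeable : List (Fin (n + m)) → Fin (n + m) → Set
  Probeable Q u = u ∈ Q ⊎ inH n u ≡ true

  allowed-probeable : ∀ f {u Q} → Probeable Q u → allowed A G H r f u Q ≡ true
  allowed-probeable f {u} {Q} p with any? (_≟_ u) Q | p
  ... | yes _ | _ = refl
  ... | no u∉Q | inj₁ u∈Q = ⊥-elim (u∉Q u∈Q)
  ... | no _ | inj₂ u∈H = u∈H

  sim-halt : ∀ f fuel πq Q h → next A (n + m) r πq h ≡ nothing →
    simLoop A G H r f (suc fuel) πq Q h ≡ true
  sim-halt f fuel πq Q h halts rewrite halts = refl

  sim-probe : ∀ f fuel πq Q h {w u} → next A (n + m) r πq h ≡ just w → f ⟨$⟩ʳ u ≡ w →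
    Probeable Q u →
    simLoop A G H r f (suc fuel) πq Q h ≡
      simLoop A G H r f fuel πq (unionAdj G H u ++ Q) ((w , List.map (f ⟨$⟩ʳ_) (unionAdj G H u)) ∷ h)
  sim-probe f fuel πq Q h {w} probes fu≡w = unfold (trans (cong (f ⟨$⟩ˡ_) (sym fu≡w)) (inverseˡ f))
    where
    unfold : ∀ {u} → f ⟨$⟩ˡ w ≡ u → Probeable Q u → simLoop A G H r f (suc fuel) πq Q h ≡
      simLoop A G H r f fuel πq (unionAdj G H u ++ Q) ((w , List.map (f ⟨$⟩ʳ_) (unionAdj G H u)) ∷ h)
    unfold refl p rewrite probes | allowed-probeable f p = refl

module Analysis {t s : ℕ → ℕ} (A : LCA t s) (Δ n m : ℕ) (G : Graph n) (H : Graph m)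
                (degG : MaxDegree≤ Δ G) (degH : MaxDegree≤ Δ H) (F : List (Permutation′ (n + m)))
                (K : ℕ) (K<N : K < n + m) (kwise : KWiseIndependent K F)
                (r : Vec Bool (s (n + m))) where

  N : ℕ
  N = n + m

  open Assignments F
  open Independence K K<N kwise
  open Unfolding A G H r

  fails : Permutation′ N → ℕ → Fin N → List (Fin N) → History N → ℕ
  fails f fuel πq Q h = isFalse (simLoop A G H r f fuel πq Q h)

  fails≤1 : ∀ f fuel πq Q h → fails f fuel πq Q h ≤ 1
  fails≤1 f fuel πq Q h = 𝟙≤1 (simLoop A G H r f fuel πq Q h Bool.≟ false)

  record Invariant (Q : List (Fin N)) {j} (xs : Vec (Fin N) j) : Set where
    field
      discovered⇒assigned : ∀ {v} → v ∈ Q → v ∈ᵥ xs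
      assigned⇒probeable : ∀ {v} → v ∈ᵥ xs → Probeable Q v

  -- The same while the freshly revealed (hence discovered) nodes zs still
  -- await assignment.
  record Pending (zs Q : List (Fin N)) {j} (xs : Vec (Fin N) j) : Set where
    field
      pending⇒discovered : ∀ {v} → v ∈ zs → v ∈ Q
      discovered⇒covered : ∀ {v} → v ∈ Q → v ∈ zs ⊎ v ∈ᵥ xs
      assigned⇒probeable : ∀ {v} → v ∈ᵥ xs → Probeable Q v

  reveal : ∀ Lu {Q j} {xs : Vec (Fin N) j} → Invariant Q xs → Pending Lu (Lu ++ Q) xs
  reveal Lu inv = record
    { pending⇒discovered = ∈-++⁺ˡ
    ; discovered⇒covered = λ v∈ → Sum.map₂ discovered⇒assigned (∈-++⁻ Lu v∈)
    ; assigned⇒probeable = λ v∈ → Sum.map₁ (∈-++⁺ʳ Lu) (assigned⇒probeable v∈)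
    }
    where open Invariant inv

  pending-assigned : ∀ {z zs Q j} {xs : Vec (Fin N) j} → z ∈ᵥ xs → Pending (z ∷ zs) Q xs → Pending zs Q xs
  pending-assigned {z} {zs} {xs = xs} z∈ pending = record
    { pending⇒discovered = pending⇒discovered ∘ there
    ; discovered⇒covered = λ v∈ → covered (discovered⇒covered v∈)
    ; assigned⇒probeable = assigned⇒probeable
    }
    where
    open Pending pending
    covered : ∀ {v} → v ∈ z ∷ zs ⊎ v ∈ᵥ xs → v ∈ zs ⊎ v ∈ᵥ xs
    covered (inj₁ (here refl)) = inj₂ z∈
    covered (inj₁ (there v∈)) = inj₁ v∈
    covered (inj₂ v∈) = inj₂ v∈

  pending-assign : ∀ {z zs Q j} {xs : Vec (Fin N) j} → Pending (z ∷ zs) Q xs → Pending zs Q (z ∷ xs)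
  pending-assign {z} {zs} {xs = xs} pending = record
    { pending⇒discovered = pending⇒discovered ∘ there
    ; discovered⇒covered = λ v∈ → covered (discovered⇒covered v∈)
    ; assigned⇒probeable = λ { (here refl) → inj₁ (pending⇒discovered (here refl))
                             ; (there v∈) → assigned⇒probeable v∈ }
    }
    where
    open Pending pending
    covered : ∀ {v} → v ∈ z ∷ zs ⊎ v ∈ᵥ xs → v ∈ zs ⊎ v ∈ᵥ (z ∷ xs)
    covered (inj₁ (here refl)) = inj₂ (here refl)
    covered (inj₁ (there v∈)) = inj₁ v∈
    covered (inj₂ v∈) = inj₂ (there v∈)

  settled : ∀ {Q j} {xs : Vec (Fin N) j} → Pending [] Q xs → Invariant Q xs
  settled {xs = xs} pending = record
    { discovered⇒assigned = λ v∈ → only-assigned (discovered⇒covered v∈)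
    ; assigned⇒probeable = assigned⇒probeable
    }
    where
    open Pending pending
    only-assigned : ∀ {v} → v ∈ [] ⊎ v ∈ᵥ xs → v ∈ᵥ xs
    only-assigned (inj₂ v∈) = v∈

  assign-H : ∀ {u Q j} {xs : Vec (Fin N) j} → inH n u ≡ true → Invariant Q xs → Invariant Q (u ∷ xs)
  assign-H u∈H inv = record
    { discovered⇒assigned = there ∘ discovered⇒assigned
    ; assigned⇒probeable = λ { (here refl) → inj₂ u∈H ; (there v∈) → assigned⇒probeable v∈ }
    }
    where open Invariant inv

  -- Budget: j assigned nodes plus Δ + 1 (a probe and its neighbours) per
  -- remaining step stay within K. A step spends one probe ...
  budget-step : ∀ {j l} fuel → l ≤ Δ → j + suc fuel * (Δ + 1) ≤ K → suc j + l + fuel * (Δ + 1) ≤ K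
  budget-step {j} {l} fuel l≤Δ budget = ≤-trans spend budget
    where
    open ≤-Reasoning
    spend : suc j + l + fuel * (Δ + 1) ≤ j + suc fuel * (Δ + 1)
    spend = begin
      suc j + l + fuel * (Δ + 1)    ≤⟨ +-monoˡ-≤ (fuel * (Δ + 1)) (+-monoʳ-≤ (suc j) l≤Δ) ⟩
      suc j + Δ + fuel * (Δ + 1)    ≡⟨ cong (_+ fuel * (Δ + 1)) (trans (sym (+-suc j Δ)) (cong (j +_) (+-comm 1 Δ))) ⟩
      j + (Δ + 1) + fuel * (Δ + 1)  ≡⟨ +-assoc j (Δ + 1) (fuel * (Δ + 1)) ⟩
      j + suc fuel * (Δ + 1) ∎

  budget-room : ∀ {j} fuel → j + suc fuel * (Δ + 1) ≤ K → j < K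
  budget-room {j} fuel budget = <-≤-trans (m<m+n j (s≤s z≤n)) (≤-trans (+-monoʳ-≤ j step≥1) budget)
    where
    step≥1 : 1 ≤ suc fuel * (Δ + 1)
    step≥1 = ≤-trans (m≤n+m 1 Δ) (m≤m+n (Δ + 1) (fuel * (Δ + 1)))

  -- Each probe of a new
  -- identifier lands on a node of G with probability ≤ n / (N ∸ K).
  FailureBound : ℕ → Set
  FailureBound fuel = ∀ {j} (xs ys : Vec (Fin N) j) πq Q h → Unique xs → Unique ys →
    j + fuel * (Δ + 1) ≤ K → Invariant Q xs →
    weight xs ys (λ f → fails f fuel πq Q h) * (N ∸ K) ≤ fuel * n * count xs ys

  -- After a probe, its revealed neighbours are assigned one by one
  -- (conditioning on their images); once all are assigned, the history
  -- entry no longer depends on the realiser and the claim applies.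
  absorb : ∀ {fuel} → FailureBound fuel → ∀ zs {j} (xs ys : Vec (Fin N) j) πq w Q Ls h →
    Unique xs → Unique ys → j + length zs + fuel * (Δ + 1) ≤ K →
    (∀ {v} → v ∈ Ls → v ∈ Q) → Pending zs Q xs →
    weight xs ys (λ f → fails f fuel πq Q ((w , List.map (f ⟨$⟩ʳ_) Ls) ∷ h)) * (N ∸ K) ≤ fuel * n * count xs ys
  absorb {fuel} bound [] {j} xs ys πq w Q Ls h uxs uys budget Ls⊆Q pending =
    subst (λ a → a * (N ∸ K) ≤ fuel * n * count xs ys) (sym (weight-cong xs ys history-determined))
      (bound xs ys πq Q ((w , List.map (assigned xs ys) Ls) ∷ h) uxs uys
        (subst (λ a → a + fuel * (Δ + 1) ≤ K) (+-identityʳ j) budget) inv)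
    where
    inv : Invariant Q xs
    inv = settled pending
    history-determined : ∀ f → f ⊨ xs ↦ ys →
      fails f fuel πq Q ((w , List.map (f ⟨$⟩ʳ_) Ls) ∷ h) ≡ fails f fuel πq Q ((w , List.map (assigned xs ys) Ls) ∷ h)
    history-determined f f⊨ = cong (λ ℓ → fails f fuel πq Q ((w , ℓ) ∷ h))
      (List.map-cong-local (ListAll.tabulate λ v∈ →
        assigned-correct {f = f} xs ys f⊨ (Invariant.discovered⇒assigned inv (Ls⊆Q v∈))))
  absorb {fuel} bound (z ∷ zs) {j} xs ys πq w Q Ls h uxs uys budget Ls⊆Q pending with z ∈ᵥ? xs
  ... | yes z∈ = absorb {fuel} bound zs xs ys πq w Q Ls h uxs uys
        (≤-trans (+-monoˡ-≤ (fuel * (Δ + 1)) (+-monoʳ-≤ j (n≤1+n (length zs)))) budget)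
        Ls⊆Q (pending-assigned z∈ pending)
  ... | no z∉ = image-split-bound z xs ys run (N ∸ K) (fuel * n) piece
    where
    run : Permutation′ N → ℕ
    run f = fails f fuel πq Q ((w , List.map (f ⟨$⟩ʳ_) Ls) ∷ h)
    piece : ∀ y → weight (z ∷ xs) (y ∷ ys) run * (N ∸ K) ≤ fuel * n * count (z ∷ xs) (y ∷ ys)
    piece y with y ∈ᵥ? ys
    ... | yes y∈ = weight-vanishing-bound (z ∷ xs) (y ∷ ys) {run}
                     (λ f f⊨ → ⊥-elim (new↦used {f = f} z∉ y∈ f⊨))
    ... | no y∉ = absorb {fuel} bound zs (z ∷ xs) (y ∷ ys) πq w Q Ls h (unique-∷ z∉ uxs) (unique-∷ y∉ uys)
          (subst (λ a → a + fuel * (Δ + 1) ≤ K) (+-suc j (length zs)) budget) Ls⊆Q (pending-assign pending)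

  continue : ℕ → Fin N → List (Fin N) → History N → Fin N → Fin N → Permutation′ N → ℕ
  continue fuel πq Q h w u f =
    fails f fuel πq (unionAdj G H u ++ Q) ((w , List.map (f ⟨$⟩ʳ_) (unionAdj G H u)) ∷ h)

  -- A probe of an already assigned identifier: its node is known to all
  -- realisers and probeable, so the run continues and only its neighbours
  -- need to be assigned.
  known-probe : ∀ {fuel} → FailureBound fuel → ∀ {j} (xs ys : Vec (Fin N) j) πq Q h {w} →
    Unique xs → Unique ys → j + suc fuel * (Δ + 1) ≤ K → Invariant Q xs →
    next A N r πq h ≡ just w → w ∈ᵥ ys →
    weight xs ys (λ f → fails f (suc fuel) πq Q h) * (N ∸ K) ≤ suc fuel * n * count xs ys
  known-probe {fuel} bound xs ys πq Q h {w} uxs uys budget inv probes w∈ with preimage xs ys w∈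
  ... | u , u∈ , fu≡w = begin
    weight xs ys (λ f → fails f (suc fuel) πq Q h) * (N ∸ K)
      ≡⟨ cong (_* (N ∸ K)) (weight-cong xs ys λ f f⊨ → cong isFalse
           (sim-probe f fuel πq Q h probes (fu≡w f f⊨) (Invariant.assigned⇒probeable inv u∈))) ⟩
    weight xs ys (continue fuel πq Q h w u) * (N ∸ K)
      ≤⟨ absorb {fuel} bound Lu xs ys πq w (Lu ++ Q) Lu h uxs uys
           (≤-trans (n≤1+n _) (budget-step fuel (unionAdj-degree degG degH u) budget)) ∈-++⁺ˡ (reveal Lu inv) ⟩
    fuel * n * count xs ys
      ≤⟨ *-monoˡ-≤ (count xs ys) (*-monoˡ-≤ n (n≤1+n fuel)) ⟩
    suc fuel * n * count xs ys ∎
    where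
    open ≤-Reasoning
    Lu : List (Fin N)
    Lu = unionAdj G H u

  new-probe-in-H : ∀ {fuel} → FailureBound fuel → ∀ {j} (xs ys : Vec (Fin N) j) πq Q h {w u} →
    Unique xs → Unique ys → j + suc fuel * (Δ + 1) ≤ K → Invariant Q xs →
    next A N r πq h ≡ just w → ¬ u ∈ᵥ xs → ¬ w ∈ᵥ ys → inH n u ≡ true →
    weight (u ∷ xs) (w ∷ ys) (λ f → fails f (suc fuel) πq Q h) * (N ∸ K) ≤ fuel * n * count (u ∷ xs) (w ∷ ys)
  new-probe-in-H {fuel} bound xs ys πq Q h {w} {u} uxs uys budget inv probes u∉ w∉ u∈H = begin
    weight (u ∷ xs) (w ∷ ys) (λ f → fails f (suc fuel) πq Q h) * (N ∸ K)
      ≡⟨ cong (_* (N ∸ K)) (weight-cong (u ∷ xs) (w ∷ ys) λ f f⊨ → cong isFalse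
           (sim-probe f fuel πq Q h probes (∷-injectiveˡ f⊨) (inj₂ u∈H))) ⟩
    weight (u ∷ xs) (w ∷ ys) (continue fuel πq Q h w u) * (N ∸ K)
      ≤⟨ absorb {fuel} bound Lu (u ∷ xs) (w ∷ ys) πq w (Lu ++ Q) Lu h (unique-∷ u∉ uxs) (unique-∷ w∉ uys)
           (budget-step fuel (unionAdj-degree degG degH u) budget) ∈-++⁺ˡ (reveal Lu (assign-H u∈H inv)) ⟩
    fuel * n * count (u ∷ xs) (w ∷ ys) ∎
    where
    open ≤-Reasoning
    Lu : List (Fin N)
    Lu = unionAdj G H u

  -- A probe of a new identifier w: condition on its preimage u. If u is a
  -- node of G the run may fail, which costs at most the count of the
  -- realisers (n nodes, each hit with probability ≤ 1 / (N ∸ K)); if u is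
  -- in H the run continues.
  new-probe : ∀ {fuel} → FailureBound fuel → ∀ {j} (xs ys : Vec (Fin N) j) πq Q h {w} →
    Unique xs → Unique ys → j + suc fuel * (Δ + 1) ≤ K → Invariant Q xs →
    next A N r πq h ≡ just w → ¬ w ∈ᵥ ys →
    weight xs ys (λ f → fails f (suc fuel) πq Q h) * (N ∸ K) ≤ suc fuel * n * count xs ys
  new-probe {fuel} bound xs ys πq Q h {w} uxs uys budget inv probes w∉ =
    subst (weight xs ys run * (N ∸ K) ≤_) total
      (weight-split-bound (preimage-match w) xs ys run (N ∸ K) (fuel * n) inG piece)
    where
    run : Permutation′ N → ℕ
    run f = fails f (suc fuel) πq Q h
    c : ℕ
    c = count xs ys
    inG : Fin N → ℕ
    inG u = isFalse (inH n u) * c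
    piece : ∀ u → weight (u ∷ xs) (w ∷ ys) run * (N ∸ K) ≤ inG u + fuel * n * count (u ∷ xs) (w ∷ ys)
    piece u with u ∈ᵥ? xs
    ... | yes u∈ = weight-vanishing-bound (u ∷ xs) (w ∷ ys) {run}
                     (λ f f⊨ → ⊥-elim (used↦new {f = f} u∈ w∉ f⊨))
    ... | no u∉ with inH n u in side
    ...   | false = ≤-trans (fresh-pair-bound (budget-room fuel budget) xs ys u w u∉ w∉ uxs uys {run}
                               (λ f → fails≤1 f (suc fuel) πq Q h))
                      (≤-trans (m≤m+n c 0) (m≤m+n (c + 0) _))
    ...   | true = ≤-trans (new-probe-in-H {fuel} bound xs ys πq Q h uxs uys budget inv probes u∉ w∉ side)
                     (m≤n+m _ 0)
    total : sum inG + fuel * n * c ≡ suc fuel * n * c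
    total = begin
      sum inG + fuel * n * c                   ≡⟨ cong (_+ fuel * n * c) (*-distribʳ-sum c (λ u → isFalse (inH n u))) ⟨
      (∑[ u < N ] isFalse (inH n u)) * c + fuel * n * c ≡⟨ cong (λ a → a * c + fuel * n * c) (count-G-nodes n) ⟩
      n * c + fuel * n * c                     ≡⟨ *-distribʳ-+ c n (fuel * n) ⟨
      suc fuel * n * c ∎
      where open ≡-Reasoning

  failure-bound-step : ∀ {fuel} → FailureBound fuel → FailureBound (suc fuel)
  failure-bound-step {fuel} bound xs ys πq Q h uxs uys budget inv = by-next (next A N r πq h) refl
    where
    by-next : ∀ mw → next A N r πq h ≡ mw →
      weight xs ys (λ f → fails f (suc fuel) πq Q h) * (N ∸ K) ≤ suc fuel * n * count xs ys
    by-next nothing halts = weight-vanishing-bound xs ys (λ f _ → cong isFalse (sim-halt f fuel πq Q h halts))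
    by-next (just w) probes with w ∈ᵥ? ys
    ... | yes w∈ = known-probe bound xs ys πq Q h uxs uys budget inv probes w∈
    ... | no w∉ = new-probe bound xs ys πq Q h uxs uys budget inv probes w∉

  failure-bound : ∀ fuel → FailureBound fuel
  failure-bound zero xs ys πq Q h uxs uys budget inv = weight-vanishing-bound xs ys (λ f _ → refl)
  failure-bound (suc fuel) = failure-bound-step (failure-bound fuel)

  -- The run on query q starts with q discovered and A told the identifier
  -- of q: condition on that identifier and apply the claim.
  query-failure-bound : ∀ fuel (q : Fin n) → 1 + fuel * (Δ + 1) ≤ K →
    weight [] [] (λ f → fails f fuel (f ⟨$⟩ʳ (q ↑ˡ m)) ((q ↑ˡ m) ∷ []) []) * (N ∸ K) ≤ fuel * n * length F
  query-failure-bound fuel q budget =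
    subst (λ c → weight [] [] run * (N ∸ K) ≤ fuel * n * c) count-empty
      (image-split-bound q′ [] [] run (N ∸ K) (fuel * n) piece)
    where
    q′ : Fin N
    q′ = q ↑ˡ m
    run : Permutation′ N → ℕ
    run f = fails f fuel (f ⟨$⟩ʳ q′) (q′ ∷ []) []
    inv : Invariant (q′ ∷ []) (q′ ∷ [])
    inv = record
      { discovered⇒assigned = λ { (here v≡q′) → here v≡q′ }
      ; assigned⇒probeable = λ { (here v≡q′) → inj₁ (here v≡q′) }
      }
    piece : ∀ y → weight (q′ ∷ []) (y ∷ []) run * (N ∸ K) ≤ fuel * n * count (q′ ∷ []) (y ∷ [])
    piece y = subst (λ a → a * (N ∸ K) ≤ fuel * n * count (q′ ∷ []) (y ∷ []))
      (weight-cong (q′ ∷ []) (y ∷ []) (λ f f⊨ → cong (λ πq → fails f fuel πq (q′ ∷ []) []) (sym (∷-injectiveˡ f⊨))))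
      (failure-bound fuel (q′ ∷ []) (y ∷ []) y (q′ ∷ []) [] ([] ∷ []) ([] ∷ []) budget inv)

lemma13 : (t s : ℕ → ℕ) (A : LCA t s) (Δ n m : ℕ)
    (G : Graph n) (H : Graph m) → MaxDegree≤ Δ G → MaxDegree≤ Δ H →
    (1 + (Δ + 1) * t (n + m)) < n + m →
    (F : List (Permutation′ (n + m))) →
    KWiseIndependent (1 + (Δ + 1) * t (n + m)) F →
    (q : Fin n) (r : Vec Bool (s (n + m))) →
    failCount A G H r F q * ((n + m) ∸ (1 + (Δ + 1) * t (n + m)))
    ≤ (1 + (Δ + 1) * t (n + m)) * n * length F
lemma13 t s A Δ n m G H degG degH k<N F kwise q r = begin
  failCount A G H r F q * (N ∸ k)
    ≡⟨ cong (_* (N ∸ k)) (trans (length-filter-sum _ F) (sym (weight-empty (λ f → isFalse (SIM A G H r f q))))) ⟩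
  weight [] [] (λ f → isFalse (SIM A G H r f q)) * (N ∸ k)
    ≤⟨ query-failure-bound (t N) q (≤-reflexive (cong suc (*-comm (t N) (Δ + 1)))) ⟩
  t N * n * length F
    ≤⟨ *-monoˡ-≤ (length F) (*-monoˡ-≤ n t≤k) ⟩
  k * n * length F ∎
  where
  N k : ℕ
  N = n + m
  k = 1 + (Δ + 1) * t N
  open Analysis A Δ n m G H degG degH F k k<N kwise r using (query-failure-bound)
  open Assignments F using (weight; weight-empty)
  open ≤-Reasoning
  t≤k : t N ≤ k
  t≤k = ≤-trans (m≤m+n (t N) (Δ * t N)) (≤-trans (≤-reflexive (cong (_* t N) (+-comm 1 Δ))) (n≤1+n _))
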